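{- Let $k$ be a positive integer and let $G$ be a graph that does not contain $K_k$ as a topological minor. Let $(T,\beta)$ be a tree decomposition of $G$ as provided by the Grohe–Marx decomposition theorem, with constants $a(k),c(k),d(k),e(k)$. Consider any run of the Construction on $G$, let $1\le i<\ell$, let $C$ be a component of $G_i$, and let $H_{i_1},\ldots,H_{i_s}$ be the subgraphs among $H_1,\ldots,H_i$ that are connected to $C$. If $s>\max\{a(k),e(k)\}$, then the core node of the minor model $H_{i_1},\ldots,H_{i_s}$ is a bounded degree node.
   Context: A tree decomposition of $G$ is a pair $(T,\beta)$ with $T$ a tree and $\beta:V(T)\to 2^{V(G)}$ such that for every $v\in V(G)$ the set $\{t:v\in\beta(t)\}$ is non-empty and connected in $T$, and every edge of $G$ is contained in some $\beta(t)$. Its adhesion is $\max\{|\beta(s)\cap\beta(t)|:st\in E(T)\}$. The torso at $t$ is $\tau(t):=G[\beta(t)]$ together with all edges making each $\beta(s)\cap\beta(t)$, $st\in E(T)$, a clique. Grohe–Marx decomposition theorem: for every $k$ there are constants $a(k),c(k),d(k),e(k)$ such that every graph excluding $K_k$ as a topological minor has a tree decomposition of adhesion at most $a(k)$ in which every node $t$ is a bounded degree node ($\tau(t)$ has at most $c(k)$ vertices of degree larger than $d(k)$) or an excluded minor node ($\tau(t)$ does not contain $K_{e(k)}$ as a minor). $K_k$ is a topological minor of $G$ if there are $k$ distinct vertices and pairwise internally vertex-disjoint paths connecting every pair of them. When $s>a(k)$, the core node of the minor model $H_{i_1},\ldots,H_{i_s}$ is the node $t\in V(T)$ whose bag $\beta(t)$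 intersects at least $a(k)+1$ of the branch sets $V(H_{i_j})$ (such a node exists and is unique). Construction. One iteratively builds pairwise vertex-disjoint connected subgraphs $H_1,\ldots,H_\ell$ covering $V(G)$. Let $G_i:=G-\bigcup_{j\le i}V(H_j)$. A component $C$ of $G_i$ is connected to $H_j$ ($j\le i$) if some edge of $G$ joins $V(H_j)$ and $V(C)$. Start with $H_1:=G[\{v\}]$ for an arbitrary $v$. Given $H_1,\ldots,H_i$ not covering $V(G)$, fix a component $C$ of $G_i$, let $H_{i_1},\ldots,H_{i_s}$ be the subgraphs connected to $C$ (they are pairwise joined by edges of $G$, forming a minor model of $K_s$), for $v\in V(C)$ let $m_i(v)$ be the maximum number of paths connecting $v$ with distinct $H_{i_j}$, with internal vertices in $G_i$, pairwise disjoint apart from $v$; choose $v\in V(C)$ maximising $m_i(v)$, take a BFS tree of $C$ rooted at $v$, and let $H_{i+1}$ be a minimal connected subtree of it containing $v$ and, for each $j$, a vertex of $C$ adjacent to $H_{i_j}$. Open choices are arbitrary. -}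

module Defs where

open import Level using (0ℓ)
open import Data.Nat using (ℕ; zero; suc; _+_; _≤_; _<_; _⊔_)
open import Data.Fin using (Fin; _≟_)
open import Data.Fin.Properties using (any?)
open import Data.Fin.Subset using (Subset; _∈_; _∉_; _∩_; ∣_∣; ⁅_⁆; Nonempty; _⊆_)
open import Data.Fin.Subset.Properties using (_∈?_)
open import Data.List using (List; []; _∷_; _++_; length; map; upTo)
open import Data.List.Relation.Unary.All using (All)
open import Data.List.Relation.Unary.Linked using (Linked)
open import Data.List.Relation.Unary.Unique.Propositional using (Unique)
open import Data.List.Membership.Propositional using () renaming (_∈_ to _∈ₗ_)
open import Data.Product using (Σ; ∃; ∃-syntax; _×_; _,_)
open import Data.Sum using (_⊎_)
open import Relation.Nullary using (¬_; Dec; yes; no; does)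
open import Relation.Nullary.Decidable using (_×-dec_; _⊎-dec_; ¬?)
open import Relation.Unary using (Pred; Decidable)
open import Relation.Binary.PropositionalEquality using (_≡_; _≢_)
open import Data.Bool using (if_then_else_)

record Graph : Set₁ where
  field
    n      : ℕ
    Adj    : Fin n → Fin n → Set
    adj?   : ∀ x y → Dec (Adj x y)
    sym    : ∀ {x y} → Adj x y → Adj y x
    irrefl : ∀ {x} → ¬ Adj x x

open Graph public

count : ∀ {A : Set} {P : Pred A 0ℓ} → Decidable P → List A → ℕ
count P? []       = 0
count P? (x ∷ xs) = if does (P? x) then suc (count P? xs) else count P? xs

countFin : ∀ {m} {P : Pred (Fin m) 0ℓ} → Decidable P → ℕ
countFin {m} P? = count P? (Data.List.allFin m)

oneTo : ℕ → List ℕ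
oneTo i = map suc (upTo i)

module _ {n : ℕ} (R : Fin n → Fin n → Set) where

  IsPath : Fin n → List (Fin n) → Fin n → Set
  IsPath u mid v = Linked R (u ∷ mid ++ v ∷ []) × Unique (u ∷ mid ++ v ∷ [])

  PathWithin : (Fin n → Set) → Fin n → List (Fin n) → Fin n → Set
  PathWithin U u mid v = IsPath u mid v × All U (u ∷ mid ++ v ∷ [])

  ConnectedIn : (Fin n → Set) → Set
  ConnectedIn U = ∀ u v → U u → U v → u ≡ v ⊎ ∃[ mid ] PathWithin U u mid v

  HasCycle : Set
  HasCycle = ∃[ u ] ∃[ mid ] ∃[ v ] (IsPath u mid v × 1 ≤ length mid × R v u)

IsTree : Graph → Set
IsTree T = (1 ≤ n T) × ConnectedIn (Adj T) (λ _ → Data.Unit.⊤) × ¬ HasCycle (Adj T)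
  where import Data.Unit

-- Topological minors: K_k is a topological minor of G if there are k
-- distinct branch vertices f, and for every pair p ≠ q a path from f p to
-- f q, such that the paths are independent (no path contains an inner
-- vertex of another one).

TopMinorK : (G : Graph) → ℕ → Set
TopMinorK G k =
  Σ (Fin k → Fin (n G)) λ f →
  (∀ p q → p ≢ q → f p ≢ f q) ×
  Σ (Fin k → Fin k → List (Fin (n G))) λ mid →
  (∀ p q → p ≢ q → IsPath (Adj G) (f p) (mid p q) (f q)) ×
  (∀ p q p' q' → p ≢ q → p' ≢ q' → ¬ (p ≡ p' × q ≡ q') → ¬ (p ≡ q' × q ≡ p') →
     ∀ x → x ∈ₗ mid p q → ¬ (x ∈ₗ (f p' ∷ mid p' q' ++ f q' ∷ [])))

module _ {n : ℕ} (R : Fin n → Fin n → Set) (S : Subset n) where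

  HasCliqueMinor : ℕ → Set
  HasCliqueMinor e =
    Σ (Fin e → Subset n) λ B →
    (∀ p → B p ⊆ S) ×
    (∀ p → Nonempty (B p)) ×
    (∀ p → ConnectedIn R (_∈ B p)) ×
    (∀ p q → p ≢ q → ∀ x → x ∈ B p → x ∉ B q) ×
    (∀ p q → p ≢ q → ∃[ x ] ∃[ y ] (x ∈ B p × y ∈ B q × R x y))

record TreeDecomposition (G : Graph) : Set₁ where
  field
    T      : Graph
    isTree : IsTree T
    β      : Fin (n T) → Subset (n G)
    cover  : ∀ v → ∃[ t ] v ∈ β t
    conn   : ∀ v → ConnectedIn (Adj T) (λ t → v ∈ β t)
    edges  : ∀ u v → Adj G u v → ∃[ t ] (u ∈ β t × v ∈ β t)

open TreeDecomposition public

module _ {G : Graph} (D : TreeDecomposition G) where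

  AdhesionAtMost : ℕ → Set
  AdhesionAtMost a = ∀ s t → Adj (T D) s t → ∣ β D s ∩ β D t ∣ ≤ a

  TorsoAdj : Fin (n (T D)) → Fin (n G) → Fin (n G) → Set
  TorsoAdj t x y =
    x ∈ β D t × y ∈ β D t × x ≢ y ×
    (Adj G x y ⊎ ∃[ s ] (Adj (T D) s t × x ∈ β D s × y ∈ β D s))

  torsoAdj? : ∀ t x y → Dec (TorsoAdj t x y)
  torsoAdj? t x y =
    (x ∈? β D t) ×-dec (y ∈? β D t) ×-dec ¬? (x ≟ y) ×-dec
    (adj? G x y ⊎-dec any? (λ s → adj? (T D) s t ×-dec (x ∈? β D s) ×-dec (y ∈? β D s)))

  torsoDeg : Fin (n (T D)) → Fin (n G) → ℕ
  torsoDeg t x = countFin (torsoAdj? t x)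

  HighDeg : ℕ → Fin (n (T D)) → Fin (n G) → Set
  HighDeg d t x = x ∈ β D t × d < torsoDeg t x

  highDeg? : ∀ d t x → Dec (HighDeg d t x)
  highDeg? d t x = (x ∈? β D t) ×-dec (d Data.Nat.<? torsoDeg t x)

  BoundedDegreeNode : ℕ → ℕ → Fin (n (T D)) → Set
  BoundedDegreeNode c d t = countFin (highDeg? d t) ≤ c

  ExcludedMinorNode : ℕ → Fin (n (T D)) → Set
  ExcludedMinorNode e t = ¬ HasCliqueMinor (TorsoAdj t) (β D t) e

-- The Construction.  H : ℕ → Subset (n G), H j the vertex set of H_j
-- (only 1 ≤ j ≤ ℓ is meaningful).

module _ (G : Graph) (H : ℕ → Subset (n G)) where

  Used : ℕ → Fin (n G) → Set
  Used i x = ∃[ j ] (1 ≤ j × j ≤ i × x ∈ H j)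

  InGi : ℕ → Fin (n G) → Set
  InGi i x = ¬ Used i x

  IsComponent : ℕ → Subset (n G) → Set
  IsComponent i C =
    Nonempty C ×
    (∀ x → x ∈ C → InGi i x) ×
    ConnectedIn (Adj G) (_∈ C) ×
    (∀ x y → x ∈ C → InGi i y → Adj G x y → y ∈ C)

  ConnectedTo : ℕ → Subset (n G) → Set
  ConnectedTo j C = ∃[ x ] ∃[ y ] (x ∈ H j × y ∈ C × Adj G x y)

  connectedTo? : ∀ j C → Dec (ConnectedTo j C)
  connectedTo? j C = any? (λ x → any? (λ y → (x ∈? H j) ×-dec (y ∈? C) ×-dec adj? G x y))

  numConnected : ℕ → Subset (n G) → ℕ
  numConnected i C = count (λ j → connectedTo? j C) (oneTo i)

  Fan : ℕ → Fin (n G) → ℕ → Set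
  Fan i v p =
    Σ (Fin p → ℕ) λ J →
    Σ (Fin p → Fin (n G)) λ end →
    Σ (Fin p → List (Fin (n G))) λ mid →
    (∀ r → 1 ≤ J r × J r ≤ i) ×
    (∀ r r' → r ≢ r' → J r ≢ J r') ×
    (∀ r → end r ∈ H (J r)) ×
    (∀ r → IsPath (Adj G) v (mid r) (end r)) ×
    (∀ r → All (InGi i) (mid r)) ×
    (∀ r r' → r ≢ r' → ∀ x → x ∈ₗ (mid r ++ end r ∷ []) → ¬ (x ∈ₗ (mid r' ++ end r' ∷ [])))

  -- v maximises m_i over C: m_i(w) ≤ m_i(v) for all w ∈ C
  Maximises : ℕ → Subset (n G) → Fin (n G) → Set
  Maximises i C v = v ∈ C × (∀ w → w ∈ C → ∀ p → Fan i w p → Fan i v p)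

  IsBFSTree : Subset (n G) → Fin (n G) → (Fin (n G) → Fin (n G) → Set) → Set
  IsBFSTree C v F =
    (∀ x y → F x y → Adj G x y × x ∈ C × y ∈ C) ×
    (∀ x y → F x y → F y x) ×
    ConnectedIn F (_∈ C) ×
    ¬ HasCycle F ×
    (∀ x mid mid' → IsPath F v mid x → PathWithin (Adj G) (_∈ C) v mid' x →
       length mid ≤ length mid')

  GoodSubtree : ℕ → Subset (n G) → Fin (n G) → (Fin (n G) → Fin (n G) → Set) → Subset (n G) → Set
  GoodSubtree i C v F S =
    S ⊆ C × v ∈ S × ConnectedIn F (_∈ S) ×
    (∀ j → 1 ≤ j → j ≤ i → ConnectedTo j C →
       ∃[ y ] ∃[ x ] (y ∈ S × x ∈ H j × Adj G x y))

  Step : ℕ → Set₁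
  Step i =
    ∃[ C ] ∃[ v ] ∃[ F ]
      (IsComponent i C × Maximises i C v × IsBFSTree C v F ×
       GoodSubtree i C v F (H (suc i)) ×
       (∀ S → S ⊆ H (suc i) → GoodSubtree i C v F S → H (suc i) ⊆ S))

  IsRun : ℕ → Set₁
  IsRun ℓ =
    1 ≤ ℓ ×
    (∃[ v ] H 1 ≡ ⁅ v ⁆) ×
    (∀ i → 1 ≤ i → i < ℓ → Step i) ×
    (∀ x → Used ℓ x)

  module _ (D : TreeDecomposition G) where

    MeetsBag : Fin (n (T D)) → Subset (n G) → ℕ → Set
    MeetsBag t C j = ConnectedTo j C × Nonempty (β D t ∩ H j)

    meetsBag? : ∀ t C → Decidable (MeetsBag t C)
    meetsBag? t C j = connectedTo? j C ×-dec any? (λ x → x ∈? (β D t ∩ H j))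

    IsCoreNode : ℕ → ℕ → Subset (n G) → Fin (n (T D)) → Set
    IsCoreNode a i C t = suc a ≤ count (meetsBag? t C) (oneTo i)

-- The torso of the core node t contains K_e as a minor, so t cannot be an excluded minor node.
-- The branch sets are β(t) ∩ V(H_j) for e of the subgraphs H_j touching C.  These H_j are
-- connected and pairwise adjacent in G (each later one was grown inside a component of an
-- earlier G_m containing C), and walks of G project onto walks of the torso through the bag
-- vertices they visit, because every excursion outside β(t) leaves and re-enters through a
-- single adhesion set, which is a clique of the torso.  Each β(t) ∩ V(H_j) is nonempty:
-- otherwise H_j lies beyond some neighbour t' of t, and each of the more than a subgraphs
-- meeting β(t) would reach H_j through its own vertex of the adhesion set β(t) ∩ β(t').

module Submission where

open import Level using (0ℓ)
open import Data.Bool using (true; false)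
open import Data.Empty using (⊥-elim)
open import Data.Nat using (ℕ; suc; _≤_; _<_; _⊔_; s≤s; z≤n)
open import Data.Nat.Properties
  using (≤-trans; ≤-<-trans; <-trans; n<1+n; <-cmp; <⇒≤; suc-injective; 1+n≰n; m≤n⊔m; module ≤-Reasoning)
open import Data.Fin using (Fin; zero; suc; _≟_; inject≤)
open import Data.Fin.Properties using (inject≤-injective)
open import Data.Fin.Subset using (Subset; _∈_; _∉_; _∩_; _-_; ∣_∣; Nonempty)
open import Data.Fin.Subset.Properties
  using (_∈?_; nonempty?; x∈⁅y⁆⇒x≡y; x∈p∩q⁺; x∈p∩q⁻; p∩q⊆p; x∈p∧x≢y⇒x∈p-y; x∈p⇒∣p-x∣<∣p∣)
open import Data.List using (List; []; _∷_; _++_; length; filter; lookup)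
open import Data.List.Membership.Propositional using () renaming (_∈_ to _∈ₗ_)
open import Data.List.Membership.Propositional.Properties using (∈-lookup; ∈-map⁻; ∈-upTo⁻; ∈-filter⁻)
open import Data.List.Relation.Unary.All using (All; []; _∷_)
import Data.List.Relation.Unary.All as All
open import Data.List.Relation.Unary.All.Properties using (¬Any⇒All¬)
open import Data.List.Relation.Unary.AllPairs using ([]; _∷_)
open import Data.List.Relation.Unary.Any using (here; there; any?)
open import Data.List.Relation.Unary.Linked using (Linked; [-]; _∷_)
open import Data.List.Relation.Unary.Unique.Propositional using (Unique)
import Data.List.Relation.Unary.Unique.Propositional.Properties as Unique
open import Data.Product using (∃-syntax; _×_; _,_; proj₁; proj₂)
open import Data.Sum using (_⊎_; inj₁; inj₂)
open import Relation.Nullary using (¬_; yes; no; does)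
open import Relation.Unary using (Pred; Decidable)
open import Relation.Binary.Definitions using (tri<; tri≈; tri>)
open import Relation.Binary.PropositionalEquality using (_≡_; _≢_; refl)
import Relation.Binary.PropositionalEquality as ≡
open import Relation.Binary.Construct.Closure.ReflexiveTransitive as Star using (Star; ε; _◅_; _◅◅_)

open import Defs

module _ {A : Set} {R : A → A → Set} where

  linked-∷ʳ : ∀ {x} mid {y z} → Linked R (x ∷ mid ++ y ∷ []) → R y z →
    Linked R (x ∷ (mid ++ y ∷ []) ++ z ∷ [])
  linked-∷ʳ []       (r ∷ [-]) r' = r ∷ r' ∷ [-]
  linked-∷ʳ (m ∷ ms) (r ∷ l)   r' = r ∷ linked-∷ʳ ms l r'

module _ {n : ℕ} (R : Fin n → Fin n → Set) (U : Fin n → Set) where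

  EdgeWithin : Fin n → Fin n → Set
  EdgeWithin x y = U x × U y × R x y

  Walk : Fin n → Fin n → Set
  Walk = Star EdgeWithin

module _ {n : ℕ} {R : Fin n → Fin n → Set} {U : Fin n → Set} where

  linked⇒walk : ∀ {x} mid {y} → Linked R (x ∷ mid ++ y ∷ []) → All U (x ∷ mid ++ y ∷ []) →
    Walk R U x y
  linked⇒walk []       (r ∷ [-]) (ux ∷ uy ∷ []) = (ux , uy , r) ◅ ε
  linked⇒walk (m ∷ ms) (r ∷ l)   (ux ∷ us)      = (ux , All.head us , r) ◅ linked⇒walk ms l us

  pathWithin⇒walk : ∀ {u mid v} → PathWithin R U u mid v → Walk R U u v
  pathWithin⇒walk {mid = mid} ((l , _) , us) = linked⇒walk mid l us

  connectedIn⇒walk : ConnectedIn R U → ∀ {u v} → U u → U v → Walk R U u v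
  connectedIn⇒walk conn {u} {v} uu uv with conn u v uu uv
  ... | inj₁ refl     = ε
  ... | inj₂ (_ , p)  = pathWithin⇒walk p

  PathOrEqual : Fin n → Fin n → Set
  PathOrEqual x y = x ≡ y ⊎ ∃[ mid ] PathWithin R U x mid y

  pathWithin-suffix : ∀ {x u mid v} → x ∈ₗ (u ∷ mid ++ v ∷ []) → PathWithin R U u mid v →
    PathOrEqual x v
  pathWithin-suffix {mid = []}     (here refl)         p = inj₂ ([] , p)
  pathWithin-suffix {mid = []}     (there (here refl)) p = inj₁ refl
  pathWithin-suffix {mid = m ∷ ms} (here refl)         p = inj₂ (m ∷ ms , p)
  pathWithin-suffix {mid = m ∷ ms} (there x∈) ((_ ∷ l , _ ∷ q) , _ ∷ us) =
    pathWithin-suffix x∈ ((l , q) , us)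

  walk⇒pathOrEqual : ∀ {x y} → U x → Walk R U x y → PathOrEqual x y
  walk⇒pathOrEqual ux ε = inj₁ refl
  walk⇒pathOrEqual {x} {y} ux ((_ , ux₁ , r) ◅ w) with walk⇒pathOrEqual ux₁ w
  ... | inj₁ refl with x ≟ y
  ...   | yes x≡y = inj₁ x≡y
  ...   | no  x≢y = inj₂ ([] , (r ∷ [-] , (x≢y ∷ []) ∷ [] ∷ []) , ux ∷ ux₁ ∷ [])
  walk⇒pathOrEqual {x} {y} ux ((_ , ux₁ , r) ◅ w) | inj₂ (mid , p@((l , q) , us))
    with any? (x ≟_) (_ ∷ mid ++ y ∷ [])
  ... | yes x∈ = pathWithin-suffix x∈ p
  ... | no  x∉ = inj₂ (_ ∷ mid , (r ∷ l , ¬Any⇒All¬ _ x∉ ∷ q) , ux ∷ us)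

  walks⇒connectedIn : (∀ {u v} → U u → U v → Walk R U u v) → ConnectedIn R U
  walks⇒connectedIn walk u v uu uv = walk⇒pathOrEqual uu (walk uu uv)

  walk-end : ∀ {x y} → U x → Walk R U x y → U y
  walk-end ux ε              = ux
  walk-end _  ((_ , uy , _) ◅ w) = walk-end uy w

  walk-map : ∀ {U' : Fin n → Set} → (∀ {x} → U x → U' x) → ∀ {x y} → Walk R U x y → Walk R U' x y
  walk-map f = Star.map λ (ux , uy , r) → f ux , f uy , r

  walk-crossing : ∀ {A : Fin n → Set} → Decidable A → ∀ {x y} → Walk R U x y → A x → ¬ A y →
    ∃[ x' ] ∃[ y' ] (A x' × ¬ A y' × EdgeWithin R U x' y')
  walk-crossing A? ε ax ¬ay = ⊥-elim (¬ay ax)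
  walk-crossing A? (_◅_ {j = x₁} e w) ax ¬ay with A? x₁
  ... | yes ax₁ = walk-crossing A? w ax₁ ¬ay
  ... | no ¬ax₁ = _ , x₁ , ax , ¬ax₁ , e

  walk-reverse : (∀ {x y} → R x y → R y x) → ∀ {x y} → Walk R U x y → Walk R U y x
  walk-reverse R-sym = Star.reverse λ (ux , uy , r) → uy , ux , R-sym r

module _ {n : ℕ} {R : Fin n → Fin n → Set} {U : Fin n → Set} where

  pathWithin-firstStep : ∀ {t mid s} → PathWithin R U t mid s →
    ∃[ t₁ ] (R t t₁ × U t₁ × Walk R (_≢ t) t₁ s)
  pathWithin-firstStep {mid = []} ((r ∷ [-] , _) , _ ∷ us ∷ []) = _ , r , us , ε
  pathWithin-firstStep {mid = m ∷ ms} ((r ∷ l , t∉ ∷ _) , _ ∷ us) =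
    m , r , All.head us , linked⇒walk ms l (All.map (λ t≢ m≡t → t≢ (≡.sym m≡t)) t∉)

module Branches (T : Graph) (tree : IsTree T) (t : Fin (n T)) where

  Branch : Fin (n T) → Fin (n T) → Set
  Branch = Walk (Adj T) (_≢ t)

  neighbour≢ : ∀ {t'} → Adj T t t' → t' ≢ t
  neighbour≢ a refl = irrefl T a

  branch-unique : ∀ {t₁ t₂ s} → Adj T t t₁ → Adj T t t₂ → Branch t₁ s → Branch t₂ s → t₁ ≡ t₂
  branch-unique {t₁} {t₂} a₁ a₂ b₁ b₂
    with walk⇒pathOrEqual (neighbour≢ a₁) (b₁ ◅◅ walk-reverse (Graph.sym T) b₂)
  ... | inj₁ t₁≡t₂ = t₁≡t₂
  ... | inj₂ (mid , (l , q) , avoid) = ⊥-elim (proj₂ (proj₂ tree) cycle)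
    where
    cycle : HasCycle (Adj T)
    cycle = t₁ , mid ++ t₂ ∷ [] , t ,
      (linked-∷ʳ mid l (Graph.sym T a₂) ,
       Unique.++⁺ q ([] ∷ []) (λ { (v∈ , here v≡t) → All.lookup avoid v∈ v≡t })) ,
      nonempty mid , a₁
      where
      nonempty : ∀ xs → 1 ≤ length (xs ++ t₂ ∷ [])
      nonempty []      = s≤s z≤n
      nonempty (_ ∷ _) = s≤s z≤n

  branch-exists : ∀ {s} → s ≢ t → ∃[ t' ] (Adj T t t' × Branch t' s)
  branch-exists {s} s≢t with proj₁ (proj₂ tree) t s _ _
  ... | inj₁ t≡s = ⊥-elim (s≢t (≡.sym t≡s))
  ... | inj₂ (_ , p) with pathWithin-firstStep p
  ...   | t' , a , _ , b = t' , a , b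

  branch-avoids : ∀ {t' s} → Adj T t t' → Branch t' s → s ≢ t
  branch-avoids a = walk-end (neighbour≢ a)

module Separation (G : Graph) (D : TreeDecomposition G) (t : Fin (n (T D))) where

  open Branches (T D) (isTree D) t

  Beyond : Fin (n G) → Fin (n (T D)) → Set
  Beyond x t' = ∀ s → x ∈ β D s → Branch t' s

  ∈β-neighbour : ∀ {x s t'} → x ∈ β D t → x ∈ β D s → Adj (T D) t t' → Branch t' s → x ∈ β D t'
  ∈β-neighbour {x} {s} x∈t x∈s a b with conn D x t s x∈t x∈s
  ... | inj₁ t≡s = ⊥-elim (branch-avoids a b (≡.sym t≡s))
  ... | inj₂ (_ , p) with pathWithin-firstStep p
  ...   | t₁ , a₁ , x∈t₁ , b₁ = ≡.subst (λ u → x ∈ β D u) (branch-unique a₁ a b₁ b) x∈t₁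

  beyond : ∀ {x s₀ t'} → x ∉ β D t → x ∈ β D s₀ → Branch t' s₀ → Beyond x t'
  beyond {x} {s₀} x∉t x∈s₀ b s x∈s with conn D x s₀ s x∈s₀ x∈s
  ... | inj₁ refl    = b
  ... | inj₂ (_ , p) = b ◅◅ walk-map (λ x∈u u≡t → x∉t (≡.subst (λ u → x ∈ β D u) u≡t x∈u))
                                    (pathWithin⇒walk p)

  beyond-exists : ∀ {x} → x ∉ β D t → ∃[ t' ] (Adj (T D) t t' × Beyond x t')
  beyond-exists {x} x∉t with cover D x
  ... | s , x∈s with branch-exists {s} (λ s≡t → x∉t (≡.subst (λ u → x ∈ β D u) s≡t x∈s))
  ...   | t' , a , b = t' , a , beyond x∉t x∈s b

  beyond-neighbour : ∀ {x y t'} → Adj G x y → Beyond x t' → Adj (T D) t t' → y ∈ β D t → y ∈ β D t'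
  beyond-neighbour {x} {y} xy bx a y∈t with edges D x y xy
  ... | s , x∈s , y∈s = ∈β-neighbour y∈t y∈s a (bx s x∈s)

  beyond-step : ∀ {x y t'} → y ∉ β D t → Adj G x y → Beyond x t' → Beyond y t'
  beyond-step {x} {y} y∉t xy bx with edges D x y xy
  ... | s , x∈s , y∈s = beyond y∉t y∈s (bx s x∈s)

  graphAdj⇒torsoAdj : ∀ {x y} → Adj G x y → x ∈ β D t → y ∈ β D t → TorsoAdj D t x y
  graphAdj⇒torsoAdj xy x∈t y∈t = x∈t , y∈t , (λ { refl → irrefl G xy }) , inj₁ xy

  module _ {U : Fin (n G) → Set} where

    InBag : Fin (n G) → Set
    InBag z = z ∈ β D t × U z

    reentry : ∀ {x y t'} → Walk (Adj G) U x y → y ∈ β D t → x ∉ β D t →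
      Adj (T D) t t' → Beyond x t' → ∃[ z ] (U z × z ∈ β D t × z ∈ β D t')
    reentry ε y∈t x∉t _ _ = ⊥-elim (x∉t y∈t)
    reentry (_◅_ {j = x₁} (_ , ux₁ , xx₁) w) y∈t x∉t a bx with x₁ ∈? β D t
    ... | yes x₁∈t = x₁ , ux₁ , x₁∈t , beyond-neighbour xx₁ bx a x₁∈t
    ... | no  x₁∉t = reentry w y∈t x₁∉t a (beyond-step x₁∉t xx₁ bx)

    -- The walk has last visited β t at p and is now at x.
    Anchored : Fin (n G) → Fin (n G) → Set
    Anchored p x = p ≡ x ⊎ (x ∉ β D t × ∃[ t' ] (Adj (T D) t t' × Beyond x t' × p ∈ β D t'))

    project : ∀ {p x y} → Walk (Adj G) U x y → y ∈ β D t → InBag p → Anchored p x →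
      Walk (TorsoAdj D t) InBag p y
    project ε _   _ (inj₁ refl)         = ε
    project ε y∈t _ (inj₂ (y∉t , _))    = ⊥-elim (y∉t y∈t)
    project (_◅_ {j = x₁} (_ , ux₁ , xx₁) w) y∈t bp@(p∈t , _) (inj₁ refl)
      with x₁ ∈? β D t
    ... | yes x₁∈t =
      (bp , (x₁∈t , ux₁) , graphAdj⇒torsoAdj xx₁ p∈t x₁∈t) ◅ project w y∈t (x₁∈t , ux₁) (inj₁ refl)
    ... | no  x₁∉t with beyond-exists x₁∉t
    ...   | t' , a , bx₁ =
      project w y∈t bp (inj₂ (x₁∉t , t' , a , bx₁ , beyond-neighbour (Graph.sym G xx₁) bx₁ a p∈t))
    project {p} (_◅_ {j = x₁} (_ , ux₁ , xx₁) w) y∈t bp@(p∈t , _) (inj₂ (_ , t' , a , bx , p∈t'))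
      with x₁ ∈? β D t
    ... | no  x₁∉t = project w y∈t bp (inj₂ (x₁∉t , t' , a , beyond-step x₁∉t xx₁ bx , p∈t'))
    ... | yes x₁∈t with p ≟ x₁
    ...   | yes refl = project w y∈t bp (inj₁ refl)
    ...   | no  p≢x₁ = (bp , (x₁∈t , ux₁) , torsoAdj) ◅ project w y∈t (x₁∈t , ux₁) (inj₁ refl)
      where
      torsoAdj : TorsoAdj D t p x₁
      torsoAdj = p∈t , x₁∈t , p≢x₁ ,
        inj₂ (t' , Graph.sym (T D) a , p∈t' , beyond-neighbour xx₁ bx a x₁∈t)

    torso-walk : ∀ {x y} → Walk (Adj G) U x y → x ∈ β D t → y ∈ β D t → U x →
      Walk (TorsoAdj D t) InBag x y
    torso-walk w x∈t y∈t ux = project w y∈t (x∈t , ux) (inj₁ refl)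

module Run (G : Graph) (H : ℕ → Subset (n G)) (ℓ : ℕ) (run : IsRun G H ℓ) where

  step : ∀ m → 1 ≤ m → m < ℓ → Step G H m
  step = proj₁ (proj₂ (proj₂ run))

  InGi-antitone : ∀ {m i x} → m ≤ i → InGi G H i x → InGi G H m x
  InGi-antitone m≤i x∈Gi (j , 1≤j , j≤m , x∈j) = x∈Gi (j , 1≤j , ≤-trans j≤m m≤i , x∈j)

  component-walkClosed : ∀ {m C' a b} → IsComponent G H m C' → Walk (Adj G) (InGi G H m) a b →
    a ∈ C' → b ∈ C'
  component-walkClosed comp ε a∈ = a∈
  component-walkClosed comp ((_ , x₁∈Gm , ax₁) ◅ w) a∈ =
    component-walkClosed comp w (proj₂ (proj₂ (proj₂ comp)) _ _ a∈ x₁∈Gm ax₁)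

  H-disjoint< : ∀ {j j' x} → 1 ≤ j → j < j' → j' < ℓ → x ∈ H j → x ∉ H j'
  H-disjoint< {j} {suc m} {x} 1≤j (s≤s j≤m) j'<ℓ x∈j x∈j'
    with step m (≤-trans 1≤j j≤m) (<-trans (n<1+n m) j'<ℓ)
  ... | _ , _ , _ , comp , _ , _ , good , _ =
    proj₁ (proj₂ comp) x (proj₁ good x∈j') (j , 1≤j , j≤m , x∈j)

  H-disjoint : ∀ {j j' x} → 1 ≤ j → 1 ≤ j' → j < ℓ → j' < ℓ → j ≢ j' → x ∈ H j → x ∉ H j'
  H-disjoint {j} {j'} 1≤j 1≤j' j<ℓ j'<ℓ j≢j' with <-cmp j j'
  ... | tri< j<j' _ _ = H-disjoint< 1≤j j<j' j'<ℓ
  ... | tri≈ _ j≡j' _ = ⊥-elim (j≢j' j≡j')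
  ... | tri> _ _ j'<j = λ x∈j x∈j' → H-disjoint< 1≤j' j'<j j<ℓ x∈j' x∈j

  H-walk : ∀ {j u v} → 1 ≤ j → j < ℓ → u ∈ H j → v ∈ H j → Walk (Adj G) (_∈ H j) u v
  H-walk {1} {u} {v} _ _ u∈ v∈ with proj₁ (proj₂ run)
  ... | v₀ , H₁≡⁅v₀⁆ = ≡.subst (Walk (Adj G) (_∈ H 1) u) (≡.trans (≡v₀ u∈) (≡.sym (≡v₀ v∈))) ε
    where
    ≡v₀ : ∀ {z} → z ∈ H 1 → z ≡ v₀
    ≡v₀ {z} z∈ = x∈⁅y⁆⇒x≡y v₀ (≡.subst (z ∈_) H₁≡⁅v₀⁆ z∈)
  H-walk {suc (suc m)} _ j<ℓ u∈ v∈ with step (suc m) (s≤s z≤n) (<-trans (n<1+n (suc m)) j<ℓ)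
  ... | _ , _ , _ , _ , _ , bfs , good , _ =
    Star.map (λ (x∈ , y∈ , xy) → x∈ , y∈ , proj₁ (proj₁ bfs _ _ xy))
      (connectedIn⇒walk (proj₁ (proj₂ (proj₂ good))) u∈ v∈)

  component-⊆ : ∀ {m i C C' x y} → m ≤ i → IsComponent G H i C → IsComponent G H m C' →
    x ∈ C' → y ∈ C → Adj G x y → ∀ {z} → z ∈ C → z ∈ C'
  component-⊆ m≤i (_ , C⊆Gi , connC , _) comp' x∈C' y∈C xy z∈C =
    component-walkClosed comp'
      (walk-map (λ {u} u∈C → InGi-antitone m≤i (C⊆Gi u u∈C)) (connectedIn⇒walk connC y∈C z∈C))
      (proj₂ (proj₂ (proj₂ comp')) _ _ x∈C' (InGi-antitone m≤i (C⊆Gi _ y∈C)) xy)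

  H-adjacent< : ∀ {i C j j'} → i < ℓ → IsComponent G H i C → 1 ≤ j → j < j' → j' ≤ i →
    ConnectedTo G H j C → ConnectedTo G H j' C → ∃[ x ] ∃[ y ] (x ∈ H j × y ∈ H j' × Adj G x y)
  H-adjacent< {j = j} {suc m} i<ℓ comp 1≤j (s≤s j≤m) m<i
    (x , y , x∈j , y∈C , xy) (x' , y' , x'∈j' , y'∈C , x'y')
    with step m (≤-trans 1≤j j≤m) (<-trans m<i i<ℓ)
  ... | _ , _ , _ , comp' , _ , _ , good , _
    with proj₂ (proj₂ (proj₂ good)) j 1≤j j≤m
           (x , y , x∈j , component-⊆ (<⇒≤ m<i) comp comp' (proj₁ good x'∈j') y'∈C x'y' y∈C , xy)
  ...   | y″ , x″ , y″∈j' , x″∈j , x″y″ = x″ , y″ , x″∈j , y″∈j' , x″y″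

  H-adjacent : ∀ {i C j j'} → i < ℓ → IsComponent G H i C → 1 ≤ j → 1 ≤ j' → j ≤ i → j' ≤ i →
    j ≢ j' → ConnectedTo G H j C → ConnectedTo G H j' C → ∃[ x ] ∃[ y ] (x ∈ H j × y ∈ H j' × Adj G x y)
  H-adjacent {j = j} {j'} i<ℓ comp 1≤j 1≤j' j≤i j'≤i j≢j' cj cj' with <-cmp j j'
  ... | tri< j<j' _ _ = H-adjacent< i<ℓ comp 1≤j j<j' j'≤i cj cj'
  ... | tri≈ _ j≡j' _ = ⊥-elim (j≢j' j≡j')
  ... | tri> _ _ j'<j with H-adjacent< i<ℓ comp 1≤j' j'<j j≤i cj' cj
  ...   | x , y , x∈j' , y∈j , xy = y , x , y∈j , x∈j' , Graph.sym G xy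

module _ {A : Set} {P : Pred A 0ℓ} (P? : Decidable P) where

  count≡length-filter : ∀ xs → count P? xs ≡ length (filter P? xs)
  count≡length-filter []       = refl
  count≡length-filter (x ∷ xs) with does (P? x)
  ... | true  = ≡.cong suc (count≡length-filter xs)
  ... | false = count≡length-filter xs

  count≤∣∣-disjoint : ∀ {m} (V : A → Subset m) xs (S : Subset m) → Unique xs →
    (∀ {j j' z} → j ∈ₗ xs → j' ∈ₗ xs → j ≢ j' → z ∈ V j → z ∉ V j') →
    (∀ {j} → j ∈ₗ xs → P j → ∃[ z ] (z ∈ S × z ∈ V j)) →
    count P? xs ≤ ∣ S ∣
  count≤∣∣-disjoint V []       S _ _ _ = z≤n
  count≤∣∣-disjoint V (x ∷ xs) S (x∉xs ∷ unique) disjoint witness with P? x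
  ... | no _ = count≤∣∣-disjoint V xs S unique
                 (λ j∈ j'∈ → disjoint (there j∈) (there j'∈)) (λ j∈ → witness (there j∈))
  ... | yes px with witness (here refl) px
  ...   | z , z∈S , z∈x = ≤-trans (s≤s (count≤∣∣-disjoint V xs (S - z) unique
                                      (λ j∈ j'∈ → disjoint (there j∈) (there j'∈)) witness′))
                                  (x∈p⇒∣p-x∣<∣p∣ z∈S)
    where
    witness′ : ∀ {j} → j ∈ₗ xs → P j → ∃[ z' ] (z' ∈ S - z × z' ∈ V j)
    witness′ j∈ pj with witness (there j∈) pj
    ... | z' , z'∈S , z'∈j = z' , x∈p∧x≢y⇒x∈p-y z'∈S z'≢z , z'∈j
      where
      z'≢z : z' ≢ z
      z'≢z refl = disjoint (here refl) (there j∈) (All.lookup x∉xs j∈) z∈x z'∈j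

lookup-injective : ∀ {A : Set} {xs : List A} → Unique xs →
  ∀ {k k'} → lookup xs k ≡ lookup xs k' → k ≡ k'
lookup-injective {xs = _ ∷ _} _            {zero}  {zero}   _  = refl
lookup-injective {xs = _ ∷ _} (x∉xs ∷ _)   {zero}  {suc k'} x≡ =
  ⊥-elim (All.lookup x∉xs (∈-lookup k') x≡)
lookup-injective {xs = _ ∷ _} (x∉xs ∷ _)   {suc k} {zero}   ≡x =
  ⊥-elim (All.lookup x∉xs (∈-lookup k) (≡.sym ≡x))
lookup-injective {xs = _ ∷ _} (_ ∷ unique) {suc k} {suc k'} eq = ≡.cong suc (lookup-injective unique eq)

module CoreNode (G : Graph) (D : TreeDecomposition G) {a : ℕ} (adhesion : AdhesionAtMost D a)
  (H : ℕ → Subset (n G)) {ℓ : ℕ} (run : IsRun G H ℓ) {i : ℕ} (i<ℓ : i < ℓ)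
  {C : Subset (n G)} (comp : IsComponent G H i C) {t : Fin (n (T D))} (core : IsCoreNode G H D a i C t)
  where

  open Separation G D t
  open Run G H ℓ run

  Index : ℕ → Set
  Index j = j ∈ₗ oneTo i

  index-bounds : ∀ {j} → Index j → 1 ≤ j × j ≤ i
  index-bounds j∈ with ∈-map⁻ suc j∈
  ... | k , k∈ , refl = s≤s z≤n , ∈-upTo⁻ k∈

  index-<ℓ : ∀ {j} → Index j → j < ℓ
  index-<ℓ j∈ = ≤-<-trans (proj₂ (index-bounds j∈)) i<ℓ

  indices-unique : Unique (oneTo i)
  indices-unique = Unique.map⁺ suc-injective (Unique.upTo⁺ i)

  disjointᵢ : ∀ {j j' x} → Index j → Index j' → j ≢ j' → x ∈ H j → x ∉ H j'
  disjointᵢ j∈ j'∈ =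
    H-disjoint (proj₁ (index-bounds j∈)) (proj₁ (index-bounds j'∈)) (index-<ℓ j∈) (index-<ℓ j'∈)

  H-walkᵢ : ∀ {j u v} → Index j → u ∈ H j → v ∈ H j → Walk (Adj G) (_∈ H j) u v
  H-walkᵢ j∈ = H-walk (proj₁ (index-bounds j∈)) (index-<ℓ j∈)

  pair-walk : ∀ {j j' u v} → Index j → Index j' → j ≢ j' → ConnectedTo G H j C → ConnectedTo G H j' C →
    u ∈ H j → v ∈ H j' → Walk (Adj G) (λ z → z ∈ H j ⊎ z ∈ H j') u v
  pair-walk j∈ j'∈ j≢j' cj cj' u∈ v∈
    with H-adjacent i<ℓ comp (proj₁ (index-bounds j∈)) (proj₁ (index-bounds j'∈))
           (proj₂ (index-bounds j∈)) (proj₂ (index-bounds j'∈)) j≢j' cj cj'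
  ... | x , y , x∈j , y∈j' , xy =
    walk-map inj₁ (H-walkᵢ j∈ u∈ x∈j) ◅◅
    (inj₁ x∈j , inj₂ y∈j' , xy) ◅ walk-map inj₂ (H-walkᵢ j'∈ y∈j' v∈)

  missing⇒∉β : ∀ {j x} → ¬ Nonempty (β D t ∩ H j) → x ∈ H j → x ∉ β D t
  missing⇒∉β misses x∈j x∈t = misses (_ , x∈p∩q⁺ (x∈t , x∈j))

  meets-bag : ∀ {j₀} → Index j₀ → ConnectedTo G H j₀ C → Nonempty (β D t ∩ H j₀)
  meets-bag {j₀} j₀∈ cj₀@(b , _ , b∈j₀ , _) with nonempty? (β D t ∩ H j₀)
  ... | yes meets = meets
  ... | no misses with beyond-exists (missing⇒∉β misses b∈j₀)
  ...   | t' , tt' , beyond-b = ⊥-elim (1+n≰n (begin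
    suc a                                   ≤⟨ core ⟩
    count (meetsBag? G H D t C) (oneTo i)   ≤⟨ count≤∣∣-disjoint (meetsBag? G H D t C) H (oneTo i)
                                                 (β D t ∩ β D t') indices-unique disjointᵢ witness ⟩
    ∣ β D t ∩ β D t' ∣                      ≤⟨ adhesion t t' tt' ⟩
    a                                       ∎))
    where
    open ≤-Reasoning
    witness : ∀ {j} → Index j → MeetsBag G H D t C j → ∃[ z ] (z ∈ β D t ∩ β D t' × z ∈ H j)
    witness j∈ (cj , z₀ , z₀∈) with x∈p∩q⁻ (β D t) _ z₀∈
    ... | z₀∈t , z₀∈j
      with reentry (pair-walk j₀∈ j∈ (λ { refl → misses (z₀ , z₀∈) }) cj₀ cj b∈j₀ z₀∈j)
                   z₀∈t (missing⇒∉β misses b∈j₀) tt' beyond-b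
    ...   | z , inj₁ z∈j₀ , z∈t , _   = ⊥-elim (missing⇒∉β misses z∈j₀ z∈t)
    ...   | z , inj₂ z∈j  , z∈t , z∈t' = z , x∈p∩q⁺ (z∈t , z∈t') , z∈j

  module _ {e : ℕ} (e≤s : e ≤ numConnected G H i C) where

    touching : List ℕ
    touching = filter (λ j → connectedTo? G H j C) (oneTo i)

    e≤touching : e ≤ length touching
    e≤touching = ≡.subst (e ≤_) (count≡length-filter _ (oneTo i)) e≤s

    J : Fin e → ℕ
    J p = lookup touching (inject≤ p e≤touching)

    J-touching : ∀ p → Index (J p) × ConnectedTo G H (J p) C
    J-touching p = ∈-filter⁻ _ (∈-lookup (inject≤ p e≤touching))

    J-injective : ∀ {p q} → p ≢ q → J p ≢ J q
    J-injective p≢q Jp≡Jq = p≢q (inject≤-injective e≤touching e≤touching _ _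
      (lookup-injective (Unique.filter⁺ _ indices-unique) Jp≡Jq))

    J-disjoint : ∀ {p q x} → p ≢ q → x ∈ H (J p) → x ∉ H (J q)
    J-disjoint p≢q = disjointᵢ (proj₁ (J-touching _)) (proj₁ (J-touching _)) (J-injective p≢q)

    B : Fin e → Subset (n G)
    B p = β D t ∩ H (J p)

    B-nonempty : ∀ p → Nonempty (B p)
    B-nonempty p = meets-bag (proj₁ (J-touching p)) (proj₂ (J-touching p))

    B-disjoint : ∀ p q → p ≢ q → ∀ x → x ∈ B p → x ∉ B q
    B-disjoint p q p≢q x x∈p x∈q =
      J-disjoint p≢q (proj₂ (x∈p∩q⁻ (β D t) _ x∈p)) (proj₂ (x∈p∩q⁻ (β D t) _ x∈q))

    B-connected : ∀ p → ConnectedIn (TorsoAdj D t) (_∈ B p)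
    B-connected p = walks⇒connectedIn λ u∈ v∈ →
      let u∈t , u∈j = x∈p∩q⁻ (β D t) _ u∈
          v∈t , v∈j = x∈p∩q⁻ (β D t) _ v∈
      in walk-map x∈p∩q⁺ (torso-walk (H-walkᵢ (proj₁ (J-touching p)) u∈j v∈j) u∈t v∈t u∈j)

    B-adjacent : ∀ p q → p ≢ q → ∃[ x ] ∃[ y ] (x ∈ B p × y ∈ B q × TorsoAdj D t x y)
    B-adjacent p q p≢q with B-nonempty p | B-nonempty q
    ... | a₀ , a₀∈ | b₀ , b₀∈ with x∈p∩q⁻ (β D t) _ a₀∈ | x∈p∩q⁻ (β D t) _ b₀∈
    ...   | a₀∈t , a₀∈p | b₀∈t , b₀∈q
      with walk-crossing (_∈? H (J p))
             (torso-walk (pair-walk (proj₁ (J-touching p)) (proj₁ (J-touching q)) (J-injective p≢q)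
                                    (proj₂ (J-touching p)) (proj₂ (J-touching q)) a₀∈p b₀∈q)
                         a₀∈t b₀∈t (inj₁ a₀∈p))
             a₀∈p (λ b₀∈p → J-disjoint p≢q b₀∈p b₀∈q)
    ... | x , y , x∈p , y∉p , (x∈t , _) , (y∈t , inj₁ y∈p) , _  = ⊥-elim (y∉p y∈p)
    ... | x , y , x∈p , y∉p , (x∈t , _) , (y∈t , inj₂ y∈q) , xy =
      x , y , x∈p∩q⁺ (x∈t , x∈p) , x∈p∩q⁺ (y∈t , y∈q) , xy

    torso-hasCliqueMinor : HasCliqueMinor (TorsoAdj D t) (β D t) e
    torso-hasCliqueMinor =
      B , (λ p → p∩q⊆p (β D t) _) , B-nonempty , B-connected , B-disjoint , B-adjacent

-- Excluding K_k as a topological minor only serves to provide the decomposition.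
lemma16 : (k a c d e : ℕ) → 1 ≤ k →
    (G : Graph) → ¬ TopMinorK G k →
    (D : TreeDecomposition G) → AdhesionAtMost D a →
    (∀ t → BoundedDegreeNode D c d t ⊎ ExcludedMinorNode D e t) →
    (H : ℕ → Subset (n G)) (ℓ : ℕ) → IsRun G H ℓ →
    (i : ℕ) → 1 ≤ i → i < ℓ →
    (C : Subset (n G)) → IsComponent G H i C →
    a ⊔ e < numConnected G H i C →
    ∀ t → IsCoreNode G H D a i C t → BoundedDegreeNode D c d t
lemma16 k a c d e _ G _ D adhesion dichotomy H ℓ run i _ i<ℓ C comp a⊔e<s t core with dichotomy t
... | inj₁ boundedDegree = boundedDegree
... | inj₂ excludedMinor =
  ⊥-elim (excludedMinor (CoreNode.torso-hasCliqueMinor G D adhesion H run i<ℓ comp core e≤s))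
  where
  e≤s : e ≤ numConnected G H i C
  e≤s = <⇒≤ (≤-<-trans (m≤n⊔m a e) a⊔e<s)
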